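{- For $n \geq 2r$, if $\{2, 3\}$ is a generator of an MLCIF $\mathcal{A}\subseteq\binom{[n]}{r}$, then $\mathcal{A}=\mathcal{AHM}_3$.
   Context: $\binom{[n]}{r}$ is the family of $r$-subsets of $[n]=\{1,\dots,n\}$. A family is intersecting if no two members are disjoint. For $A=\{a_1<\dots<a_r\}$, $B=\{b_1<\dots<b_r\}$ write $B\le A$ if $b_i\le a_i$ for all $i$; $\mathcal{A}$ is left-compressed if $A\in\mathcal{A}$, $B\le A$ imply $B\in\mathcal{A}$. An MLCIF is a left-compressed intersecting family in $\binom{[n]}{r}$ maximal under inclusion among such families. A set $G\subseteq[n]$ is a potential generator of $\mathcal{A}$ if every $A\in\binom{[n]}{r}$ with $G\subseteq A$ lies in $\mathcal{A}$; a generator is an inclusion-minimal potential generator. $\mathcal{AHM}_3=\{A\in\binom{[n]}{r}: 1\in A, A\cap\{2,3\}\ne\emptyset\}\cup\{A\in\binom{[n]}{r}:\{2,3\}\subseteq A\}$. -}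

module Defs where

open import Data.Nat using (ℕ; zero; suc; _≤_)
open import Data.Bool using (Bool; true)
open import Data.List using (List; []; _∷_; map)
open import Data.List.Relation.Binary.Pointwise using (Pointwise)
open import Data.Vec using ([]; _∷_)
open import Data.Fin using (Fin; zero; suc)
open import Data.Fin.Subset using (Subset; inside; outside; _∈_; _⊆_; _⊂_; _∩_; _∪_; ⁅_⁆; ∣_∣; Nonempty)
open import Data.Product using (_×_)
open import Data.Sum using (_⊎_)
open import Relation.Binary.PropositionalEquality using (_≡_)
open import Relation.Nullary using (¬_)

-- A family of subsets of [n] (ground set Fin n; element i of [n] is the Fin index i-1).
-- Families are finite, so represented by their (Boolean) indicator functions.
Family : ℕ → Set
Family n = Subset n → Bool

_∈F_ : ∀ {n} → Subset n → Family n → Set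
A ∈F 𝒜 = 𝒜 A ≡ true

IsUniform : ∀ {n} → ℕ → Family n → Set
IsUniform r 𝒜 = ∀ A → A ∈F 𝒜 → ∣ A ∣ ≡ r

elems : ∀ {n} → Subset n → List ℕ
elems [] = []
elems (inside ∷ p) = zero ∷ map suc (elems p)
elems (outside ∷ p) = map suc (elems p)

_≼_ : ∀ {n} → Subset n → Subset n → Set
B ≼ A = Pointwise _≤_ (elems B) (elems A)

IsIntersecting : ∀ {n} → Family n → Set
IsIntersecting 𝒜 = ∀ A B → A ∈F 𝒜 → B ∈F 𝒜 → Nonempty (A ∩ B)

IsLeftCompressed : ∀ {n} → Family n → Set
IsLeftCompressed 𝒜 = ∀ A B → A ∈F 𝒜 → B ≼ A → B ∈F 𝒜

IsLCIF : ∀ {n} → ℕ → Family n → Set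
IsLCIF r 𝒜 = IsUniform r 𝒜 × IsIntersecting 𝒜 × IsLeftCompressed 𝒜

IsMLCIF : ∀ {n} → ℕ → Family n → Set
IsMLCIF {n} r 𝒜 = IsLCIF r 𝒜 ×
  (∀ (ℬ : Family n) → IsLCIF r ℬ → (∀ A → A ∈F 𝒜 → A ∈F ℬ) → ∀ A → A ∈F ℬ → A ∈F 𝒜)

IsPotentialGenerator : ∀ {n} → ℕ → Family n → Subset n → Set
IsPotentialGenerator r 𝒜 G = ∀ A → ∣ A ∣ ≡ r → G ⊆ A → A ∈F 𝒜

IsGenerator : ∀ {n} → ℕ → Family n → Subset n → Set
IsGenerator r 𝒜 G = IsPotentialGenerator r 𝒜 G × (∀ H → H ⊂ G → ¬ IsPotentialGenerator r 𝒜 H)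

one two three : ∀ {m} → Fin (suc (suc (suc m)))
one = zero
two = suc zero
three = suc (suc zero)

pair23 : ∀ {m} → Subset (suc (suc (suc m)))
pair23 = ⁅ two ⁆ ∪ ⁅ three ⁆

InAHM3 : ∀ {m} → ℕ → Subset (suc (suc (suc m))) → Set
InAHM3 r A = ∣ A ∣ ≡ r ×
  ((one ∈ A × (two ∈ A ⊎ three ∈ A)) ⊎ (two ∈ A × three ∈ A))

-- A set meeting {1,2,3} in at most one point lies ≼-above D = {1} ∪ {4, …, r+2}, so by
-- left-compression every such member of 𝒜 would put D into 𝒜.  But {2,3} is a potential
-- generator, so E = {2,3} ∪ {r+3, …, 2r} ∈ 𝒜, and D ∩ E = ∅ because n ≥ 2r: hence every
-- member of 𝒜 meets {1,2,3} twice, which is AHM₃.  Conversely {1,2} ∪ P and {1,3} ∪ P lie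
-- ≼-below {2,3} ∪ P ∈ 𝒜.
module Submission where

open import Defs
open import Data.Nat using (ℕ; zero; suc; _+_; _*_; _≤_; z≤n; s≤s)
open import Data.Fin.Subset using (Subset)
open import Function.Bundles using (_⇔_; mk⇔)

open import Data.Nat.Properties using (suc-injective; m≤m+n; ≤-refl; ≤-trans; ≤-reflexive; n≤1+n; +-cancelˡ-≤)
open import Data.Nat.Tactic.RingSolver using (solve-∀)
open import Data.List using (List; []; _∷_; map; upTo)
open import Data.List.Properties using (map-upTo)
open import Data.List.Relation.Binary.Pointwise as Pointwise using (Pointwise; []; _∷_)
open import Data.Vec using ([]; _∷_)
open import Data.Vec.Base using (here; there)
open import Data.Fin using (zero; suc)
open import Data.Fin.Subset using (inside; outside; _∈_; _∉_; _⊆_; ⁅_⁆; ∣_∣)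
open import Data.Fin.Subset.Properties using (x∈p∪q⁻; x∈p∩q⁻; x∈⁅y⁆⇒x≡y)
open import Data.Product using (_,_)
open import Data.Sum using (_⊎_; inj₁; inj₂)
open import Data.Empty using (⊥-elim)
open import Relation.Binary.PropositionalEquality using (_≡_; refl; sym; cong; subst)
open import Relation.Nullary using (¬_)

infix 4 _≤*_

_≤*_ : List ℕ → List ℕ → Set
_≤*_ = Pointwise _≤_

≤*-refl : ∀ {xs} → xs ≤* xs
≤*-refl = Pointwise.refl ≤-refl

≤*-trans : ∀ {xs ys zs} → xs ≤* ys → ys ≤* zs → xs ≤* zs
≤*-trans = Pointwise.transitive ≤-trans

map-suc-mono-≤* : ∀ {xs ys} → xs ≤* ys → map suc xs ≤* map suc ys
map-suc-mono-≤* p = Pointwise.map⁺ suc suc (Pointwise.map s≤s p)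

≤*-map-suc : ∀ xs → xs ≤* map suc xs
≤*-map-suc []       = []
≤*-map-suc (x ∷ xs) = n≤1+n x ∷ ≤*-map-suc xs

suc³ : List ℕ → List ℕ
suc³ xs = map suc (map suc (map suc xs))

suc³-mono-≤* : ∀ {xs ys} → xs ≤* ys → suc³ xs ≤* suc³ ys
suc³-mono-≤* p = map-suc-mono-≤* (map-suc-mono-≤* (map-suc-mono-≤* p))

upTo-suc : ∀ c → upTo (suc c) ≡ 0 ∷ map suc (upTo c)
upTo-suc c = cong (0 ∷_) (sym (map-upTo suc c))

upTo-≤*-∷ : ∀ {c y ys} → upTo (suc c) ≤* y ∷ ys → upTo c ≤* ys
upTo-≤*-∷ {c} {y} {ys} p with subst (_≤* y ∷ ys) (upTo-suc c) p
... | _ ∷ q = ≤*-trans (≤*-map-suc (upTo c)) q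

upTo-≤*-elems : ∀ {n c} (p : Subset n) → ∣ p ∣ ≡ c → upTo c ≤* elems p
upTo-≤*-elems []            refl = []
upTo-≤*-elems (inside ∷ p)  refl =
  subst (_≤* elems (inside ∷ p)) (sym (upTo-suc ∣ p ∣))
        (z≤n ∷ map-suc-mono-≤* (upTo-≤*-elems p refl))
upTo-≤*-elems (outside ∷ p) refl =
  ≤*-trans (upTo-≤*-elems p refl) (≤*-map-suc (elems p))

-- interval a b n = {a, …, a+b-1} (0-based), truncated to [0, n)
interval : ℕ → ℕ → (n : ℕ) → Subset n
interval _       _       zero    = []
interval zero    zero    (suc n) = outside ∷ interval zero zero n
interval zero    (suc b) (suc n) = inside ∷ interval zero b n
interval (suc a) b       (suc n) = outside ∷ interval a b n

∣interval∣ : ∀ a b n → a + b ≤ n → ∣ interval a b n ∣ ≡ b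
∣interval∣ zero    zero    zero    _         = refl
∣interval∣ zero    zero    (suc n) _         = ∣interval∣ zero zero n z≤n
∣interval∣ zero    (suc b) (suc n) (s≤s h)   = cong suc (∣interval∣ zero b n h)
∣interval∣ (suc a) b       (suc n) (s≤s h)   = ∣interval∣ a b n h

elems-interval₀ : ∀ b n → b ≤ n → elems (interval zero b n) ≡ upTo b
elems-interval₀ zero    zero    _       = refl
elems-interval₀ zero    (suc n) _       = cong (map suc) (elems-interval₀ zero n z≤n)
elems-interval₀ (suc b) (suc n) (s≤s h) =
  subst (λ xs → 0 ∷ map suc xs ≡ upTo (suc b)) (sym (elems-interval₀ b n h)) (sym (upTo-suc b))

∉interval-empty : ∀ n {x} → x ∉ interval zero zero n
∉interval-empty (suc n) (there x∈) = ∉interval-empty n x∈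

∉interval-adjacent : ∀ a b n {x} → x ∈ interval zero a n → x ∉ interval a b n
∉interval-adjacent zero    b n x∈ _ = ∉interval-empty n x∈
∉interval-adjacent (suc a) b (suc n) here       ()
∉interval-adjacent (suc a) b (suc n) (there x∈) (there y∈) = ∉interval-adjacent a b n x∈ y∈

pair23⊆ : ∀ {m} {A : Subset (suc (suc (suc m)))} → two ∈ A → three ∈ A → pair23 ⊆ A
pair23⊆ {A = A} 2∈A 3∈A x∈ with x∈p∪q⁻ ⁅ two ⁆ ⁅ three ⁆ x∈
... | inj₁ x∈⁅2⁆ = subst (_∈ A) (sym (x∈⁅y⁆⇒x≡y two x∈⁅2⁆)) 2∈A
... | inj₂ x∈⁅3⁆ = subst (_∈ A) (sym (x∈⁅y⁆⇒x≡y three x∈⁅3⁆)) 3∈A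

-- The sets D and E of the argument above, for r = k + 2.
lowSet highSet : ∀ k m → Subset (suc (suc (suc m)))
lowSet  k m = inside ∷ outside ∷ outside ∷ interval zero (suc k) m
highSet k m = outside ∷ inside ∷ inside ∷ interval (suc k) k m

lowSet∩highSet-empty : ∀ k m {x} → x ∈ lowSet k m → x ∉ highSet k m
lowSet∩highSet-empty k m {suc (suc (suc x))} (there (there (there x∈))) (there (there (there y∈))) =
  ∉interval-adjacent (suc k) k m x∈ y∈

suc³-upTo-≤* : ∀ {n c} (p : Subset n) → suc ∣ p ∣ ≡ suc c → suc³ (upTo c) ≤* suc³ (elems p)
suc³-upTo-≤* p e = suc³-mono-≤* (upTo-≤*-elems p (suc-injective e))

suc³-drop-head : ∀ {c} xs → upTo (suc c) ≤* xs → 0 ∷ suc³ (upTo c) ≤* suc³ xs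
suc³-drop-head (_ ∷ _) p = z≤n ∷ suc³-mono-≤* (upTo-≤*-∷ p)

lowSet-≼ : ∀ {k m} → suc k ≤ m → (A : Subset (suc (suc (suc m))))
  → 0 ∷ suc³ (upTo (suc k)) ≤* elems A → lowSet k m ≼ A
lowSet-≼ {k} {m} h A = subst (λ xs → 0 ∷ suc³ xs ≤* elems A) (sym (elems-interval₀ (suc k) m h))

InAHM3⊎lowSet-≼ : ∀ {k m} → suc k ≤ m → (A : Subset (suc (suc (suc m))))
  → ∣ A ∣ ≡ suc (suc k) → InAHM3 (suc (suc k)) A ⊎ lowSet k m ≼ A
InAHM3⊎lowSet-≼ h (inside  ∷ inside  ∷ _       ∷ _) e = inj₁ (e , inj₁ (here , inj₁ (there here)))
InAHM3⊎lowSet-≼ h (inside  ∷ outside ∷ inside  ∷ _) e = inj₁ (e , inj₁ (here , inj₂ (there (there here))))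
InAHM3⊎lowSet-≼ h (outside ∷ inside  ∷ inside  ∷ _) e = inj₁ (e , inj₂ (there here , there (there here)))
InAHM3⊎lowSet-≼ h A@(inside  ∷ outside ∷ outside ∷ p) e = inj₂ (lowSet-≼ h A (z≤n ∷ suc³-upTo-≤* p e))
InAHM3⊎lowSet-≼ h A@(outside ∷ inside  ∷ outside ∷ p) e = inj₂ (lowSet-≼ h A (z≤n ∷ suc³-upTo-≤* p e))
InAHM3⊎lowSet-≼ h A@(outside ∷ outside ∷ inside  ∷ p) e = inj₂ (lowSet-≼ h A (z≤n ∷ suc³-upTo-≤* p e))
InAHM3⊎lowSet-≼ h A@(outside ∷ outside ∷ outside ∷ p) e =
  inj₂ (lowSet-≼ h A (suc³-drop-head (elems p) (upTo-≤*-elems p e)))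

module _ {k m : ℕ} (room : suc k + k ≤ m) (𝒜 : Family (suc (suc (suc m))))
  (intersecting : IsIntersecting 𝒜) (compressed : IsLeftCompressed 𝒜)
  (generated : IsPotentialGenerator (suc (suc k)) 𝒜 pair23) where

  ⊇pair23∈ : ∀ A → ∣ A ∣ ≡ suc (suc k) → two ∈ A → three ∈ A → A ∈F 𝒜
  ⊇pair23∈ A e 2∈A 3∈A = generated A e (pair23⊆ 2∈A 3∈A)

  highSet∈ : highSet k m ∈F 𝒜
  highSet∈ = ⊇pair23∈ (highSet k m) (cong (λ c → suc (suc c)) (∣interval∣ (suc k) k m room))
                      (there here) (there (there here))

  lowSet∉ : ¬ lowSet k m ∈F 𝒜
  lowSet∉ low∈ with intersecting (lowSet k m) (highSet k m) low∈ highSet∈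
  ... | x , x∈ with x∈p∩q⁻ (lowSet k m) (highSet k m) x∈
  ...   | x∈low , x∈high = lowSet∩highSet-empty k m x∈low x∈high

  𝒜⊆AHM3 : ∀ A → A ∈F 𝒜 → ∣ A ∣ ≡ suc (suc k) → InAHM3 (suc (suc k)) A
  𝒜⊆AHM3 A A∈ e with InAHM3⊎lowSet-≼ (≤-trans (m≤m+n (suc k) k) room) A e
  ... | inj₁ inAHM3 = inAHM3
  ... | inj₂ low≼A  = ⊥-elim (lowSet∉ (compressed A (lowSet k m) A∈ low≼A))

  AHM3⊆𝒜 : ∀ A → InAHM3 (suc (suc k)) A → A ∈F 𝒜
  AHM3⊆𝒜 A@(_ ∷ inside ∷ inside ∷ _) (e , _) = ⊇pair23∈ A e (there here) (there (there here))
  AHM3⊆𝒜 A@(inside ∷ inside ∷ outside ∷ p) (e , _) =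
    compressed _ A (⊇pair23∈ (outside ∷ inside ∷ inside ∷ p) e (there here) (there (there here)))
               (z≤n ∷ s≤s z≤n ∷ ≤*-refl)
  AHM3⊆𝒜 A@(inside ∷ outside ∷ inside ∷ p) (e , _) =
    compressed _ A (⊇pair23∈ (outside ∷ inside ∷ inside ∷ p) e (there here) (there (there here)))
               (z≤n ∷ ≤-refl ∷ ≤*-refl)
  AHM3⊆𝒜 (inside ∷ outside ∷ outside ∷ _) (_ , inj₁ (_ , inj₁ (there ())))
  AHM3⊆𝒜 (inside ∷ outside ∷ outside ∷ _) (_ , inj₁ (_ , inj₂ (there (there ()))))
  AHM3⊆𝒜 (inside ∷ outside ∷ outside ∷ _) (_ , inj₂ (there () , _))
  AHM3⊆𝒜 (outside ∷ _ ∷ outside ∷ _)     (_ , inj₁ (() , _))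
  AHM3⊆𝒜 (outside ∷ _ ∷ outside ∷ _)     (_ , inj₂ (_ , there (there ())))
  AHM3⊆𝒜 (outside ∷ outside ∷ inside ∷ _) (_ , inj₁ (() , _))
  AHM3⊆𝒜 (outside ∷ outside ∷ inside ∷ _) (_ , inj₂ (there () , _))

room-from-2r≤n : ∀ k m → 2 * suc (suc k) ≤ suc (suc (suc m)) → suc k + k ≤ m
room-from-2r≤n k m h = +-cancelˡ-≤ 3 (suc k + k) m (≤-trans (≤-reflexive (3+[2r-3]≡2r k)) h)
  where
  3+[2r-3]≡2r : ∀ k → 3 + (suc k + k) ≡ 2 * suc (suc k)
  3+[2r-3]≡2r = solve-∀

corollary2p6 : (m r : ℕ) → 2 ≤ r → 2 * r ≤ suc (suc (suc m))
    → (𝒜 : Family (suc (suc (suc m)))) → IsMLCIF r 𝒜 → IsGenerator r 𝒜 pair23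
    → ∀ (A : Subset (suc (suc (suc m)))) → (A ∈F 𝒜) ⇔ InAHM3 r A
corollary2p6 m (suc (suc k)) (s≤s (s≤s z≤n)) 2r≤n 𝒜 ((uniform , intersecting , compressed) , _) (generated , _) A =
  mk⇔ (λ A∈ → 𝒜⊆AHM3 room 𝒜 intersecting compressed generated A A∈ (uniform A A∈))
      (AHM3⊆𝒜 room 𝒜 intersecting compressed generated A)
  where
  room : suc k + k ≤ m
  room = room-from-2r≤n k m 2r≤n
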